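{- Let $k\geqslant 5$ and let $G$ be a $C_k$-saturated graph. Let $u_0u_1\ldots u_r$ and $v_0v_1\ldots v_s$ be two vertex-disjoint paths in $G$ all of whose vertices have degree $2$ in $G$, and suppose $r+s\geqslant k-1$. If $u_0$ and $v_0$ have a common neighbor $w$, then there exists a path in $G$ between $w$ and $u_r$ of length $k-r-3$ which does not pass through $u_0$.
   Context: All graphs are finite, simple, undirected. $C_k$ is the cycle on $k$ vertices. $G$ is $C_k$-saturated if $G$ contains no subgraph isomorphic to $C_k$ and adding any edge between two nonadjacent vertices creates one. The length of a path is its number of edges. -}

module Defs where

open import Data.Nat using (ℕ; zero; suc; _+_; _∸_; _≤_)
open import Data.Fin using (Fin; zero; suc; inject₁; fromℕ; _≟_)
open import Data.Bool using (Bool; true; false; _∨_; _∧_)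
open import Data.List using (List; length; filter)
open import Data.List using () renaming (map to lmap)
open import Data.Fin using () renaming (toℕ to toℕ)
open import Data.Vec.Functional using () 
open import Data.Product using (Σ; _×_; _,_)
open import Function.Definitions using (Injective)
open import Relation.Binary.PropositionalEquality using (_≡_; _≢_)
open import Relation.Nullary using (¬_)
open import Relation.Nullary.Decidable using (⌊_⌋)
open import Data.List using (allFin)
open import Data.Bool using (T)
open import Data.Bool using () renaming (_≟_ to _≟ᵇ_)

record Graph (n : ℕ) : Set where
  field
    adj    : Fin n → Fin n → Bool
    sym    : ∀ x y → adj x y ≡ adj y x
    irrefl : ∀ x → adj x x ≡ false
open Graph public

Adjacency : ℕ → Set
Adjacency n = Fin n → Fin n → Bool

degree : ∀ {n} → Graph n → Fin n → ℕ
degree G x = length (filter (λ y → adj G x y ≟ᵇ true) (allFin _))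

record Path {n : ℕ} (A : Adjacency n) (r : ℕ) : Set where
  field
    vtx      : Fin (suc r) → Fin n
    distinct : Injective _≡_ _≡_ vtx
    edges    : ∀ (i : Fin r) → A (vtx (inject₁ i)) (vtx (suc i)) ≡ true
open Path public

start : ∀ {n r} {A : Adjacency n} → Path A r → Fin n
start P = vtx P zero

end : ∀ {n r} {A : Adjacency n} → Path A r → Fin n
end {r = r} P = vtx P (fromℕ r)

HasCycle : ∀ {n} → Adjacency n → ℕ → Set
HasCycle A k = 3 ≤ k × Σ (Path A (k ∸ 1)) (λ P → A (end P) (start P) ≡ true)

addEdge : ∀ {n} → Adjacency n → Fin n → Fin n → Adjacency n
addEdge A u v x y =
  A x y ∨ ((⌊ x ≟ u ⌋ ∧ ⌊ y ≟ v ⌋) ∨ (⌊ x ≟ v ⌋ ∧ ⌊ y ≟ u ⌋))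

Saturated : ∀ {n} → ℕ → Graph n → Set
Saturated k G =
  ¬ HasCycle (adj G) k ×
  (∀ u v → u ≢ v → adj G u v ≡ false → HasCycle (addEdge (adj G) u v) k)

-- Saturation turns every non-edge xy into a path of length k − 1 from x to y: the C_k created
-- by adding xy, minus that edge. A path that enters a chain of degree-two vertices has to run
-- along it; played against saturation paths, this shows that no path of length k − 1 consists
-- of degree-two vertices, so r, s < k − 1 and hence r, s ≥ 1. The neighbours of u₀ are w and u₁,
-- so u₀ and v₁ are not adjacent and there is a path P₀ … P_{k−1} from u₀ to v₁. If P reached v₁
-- from v₂, then either P₁ = w and v₀ P₁ … P_{k−1} is a C_k, or P runs along u from u₀ and
-- backwards along v from v₁, so that u and v meet or P consists of degree-two vertices. Hence
-- P_{k−2} = v₀ and P_{k−3} = w; then P₁ = u₁, P runs along u up to P_r = u_r, and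
-- P_{k−3} … P_r is a path of length k − 3 − r from w to u_r that misses u₀ = P₀.

module Submission where

open import Defs hiding (sym)
open import Data.Bool using (true; false; T; _∧_) renaming (_≟_ to _≟ᵇ_)
open import Data.Bool.Properties using (T-≡; T-∨; T-∧; ¬-not)
open import Data.Empty using (⊥; ⊥-elim)
open import Data.Fin using (Fin; zero; suc; toℕ; fromℕ; inject₁; _≟_)
open import Data.Fin.Properties using (toℕ-injective; toℕ<n; toℕ-fromℕ; toℕ-inject₁)
open import Data.List using (List; length; filter; allFin)
open import Data.List.Membership.Propositional using (_∈_)
open import Data.List.Membership.Propositional.Properties using (∈-length; ∈-filter⁺; ∈-allFin)
open import Data.List.Relation.Unary.Any using (here; there)
open import Data.Nat using (ℕ; zero; suc; _+_; _∸_; _≤_; _<_; z≤n; s≤s; z<s; _≤?_)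
open import Data.Nat.Properties hiding (_≟_)
open import Data.Product as Prod using (Σ; ∃-syntax; _×_; _,_; proj₁; proj₂)
open import Data.Sum as Sum using (_⊎_; inj₁; inj₂; [_,_]′)
open import Function using (_∘_; id; Equivalence)
open import Relation.Binary.PropositionalEquality using (_≡_; _≢_; refl; sym; trans; cong; subst; subst₂)
open import Relation.Nullary using (¬_; Dec; yes; no; contradiction)
open import Relation.Nullary.Decidable using (⌊_⌋; toWitness; decidable-stable)

open Equivalence using (to; from)

-- Paths indexed by ℕ rather than Fin, to keep index arithmetic in ℕ; `vertex i` is junk for i > L.
record ℕPath {n : ℕ} (A : Adjacency n) (L : ℕ) : Set where
  field
    vertex    : ℕ → Fin n
    injective : ∀ {i j} → i ≤ L → j ≤ L → vertex i ≡ vertex j → i ≡ j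
    adjacent  : ∀ {i} → i < L → A (vertex i) (vertex (suc i)) ≡ true

open ℕPath public

infixl 9 _!_
_!_ : ∀ {n L} {A : Adjacency n} → ℕPath A L → ℕ → Fin n
_!_ = vertex

module _ {n : ℕ} {A : Adjacency n} where

  !-distinct : ∀ {L i j} (P : ℕPath A L) → i ≤ L → j ≤ L → i ≢ j → P ! i ≢ P ! j
  !-distinct P i≤L j≤L i≢j = i≢j ∘ injective P i≤L j≤L

  cast : ∀ {L L'} → L ≡ L' → ℕPath A L → ℕPath A L'
  cast {L} {L'} L≡L' P = record
    { vertex    = vertex P
    ; injective = λ i≤L' j≤L' → injective P (back i≤L') (back j≤L')
    ; adjacent  = λ i<L' → adjacent P (back i<L')
    }
    where
    back : ∀ {i} → i ≤ L' → i ≤ L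
    back i≤L' = ≤-trans i≤L' (≤-reflexive (sym L≡L'))

  restrict : ∀ {B : Adjacency n} {L} (P : ℕPath B L) →
    (∀ {i} → i < L → A (P ! i) (P ! suc i) ≡ true) → ℕPath A L
  restrict P steps = record { vertex = vertex P ; injective = injective P ; adjacent = steps }

  segment : ∀ {L} (P : ℕPath A L) (a l : ℕ) → a + l ≤ L → ℕPath A l
  segment {L} P a l a+l≤L = record
    { vertex    = λ i → P ! (a + i)
    ; injective = λ i≤l j≤l eq → +-cancelˡ-≡ a _ _ (injective P (bound i≤l) (bound j≤l) eq)
    ; adjacent  = λ {i} i<l → subst (λ m → A (P ! (a + i)) (P ! m) ≡ true) (sym (+-suc a i))
                                (adjacent P (subst (_≤ L) (+-suc a i) (bound i<l)))
    }
    where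
    bound : ∀ {i} → i ≤ l → a + i ≤ L
    bound i≤l = ≤-trans (+-monoʳ-≤ a i≤l) a+l≤L

  single : Fin n → ℕPath A 0
  single x = record { vertex = λ _ → x ; injective = λ { z≤n z≤n _ → refl } ; adjacent = λ () }

  AllVertices : ∀ {L} → (Fin n → Set) → ℕPath A L → Set
  AllVertices {L} D P = ∀ {i} → i ≤ L → D (P ! i)

≤-or-beyond : ∀ a i → i ≤ a ⊎ ∃[ t ] suc a + t ≡ i
≤-or-beyond a i with i ≤? a
... | yes i≤a = inj₁ i≤a
... | no  i≰a = inj₂ (m≤n⇒∃[o]m+o≡n (≰⇒> i≰a))

private
  join : ∀ {n} → (ℕ → Fin n) → (ℕ → Fin n) → ℕ → ℕ → Fin n
  join p q zero    zero    = p 0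
  join p q zero    (suc t) = q t
  join p q (suc a) zero    = p 0
  join p q (suc a) (suc t) = join (p ∘ suc) q a t

  join-left : ∀ {n} (p q : ℕ → Fin n) a {t} → t ≤ a → join p q a t ≡ p t
  join-left p q zero    z≤n       = refl
  join-left p q (suc a) z≤n       = refl
  join-left p q (suc a) (s≤s t≤a) = join-left (p ∘ suc) q a t≤a

  join-right : ∀ {n} (p q : ℕ → Fin n) a t → join p q a (suc a + t) ≡ q t
  join-right p q zero    t = refl
  join-right p q (suc a) t = join-right (p ∘ suc) q a t

module _ {n : ℕ} {A : Adjacency n} {a b : ℕ} (P : ℕPath A a) (Q : ℕPath A b)
         (link : A (P ! a) (Q ! 0) ≡ true) (disjoint : ∀ {i j} → i ≤ a → j ≤ b → P ! i ≢ Q ! j) where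

  private
    joined : ℕ → Fin n
    joined = join (vertex P) (vertex Q) a

    right-bound : ∀ {t} → suc a + t ≤ a + suc b → t ≤ b
    right-bound {t} h = +-cancelˡ-≤ a t b (≤-pred (subst (suc a + t ≤_) (+-suc a b) h))

    joined-cases : ∀ {i} → i ≤ a + suc b →
      (i ≤ a × joined i ≡ P ! i) ⊎ ∃[ t ] (t ≤ b × suc a + t ≡ i × joined i ≡ Q ! t)
    joined-cases {i} i≤ with ≤-or-beyond a i
    ... | inj₁ i≤a         = inj₁ (i≤a , join-left (vertex P) (vertex Q) a i≤a)
    ... | inj₂ (t , refl)  = inj₂ (t , right-bound i≤ , refl , join-right (vertex P) (vertex Q) a t)

    joined-injective : ∀ {i j} → i ≤ a + suc b → j ≤ a + suc b → joined i ≡ joined j → i ≡ j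
    joined-injective i≤ j≤ eq with joined-cases i≤ | joined-cases j≤
    ... | inj₁ (i≤a , Jᵢ) | inj₁ (j≤a , Jⱼ) = injective P i≤a j≤a (trans (sym Jᵢ) (trans eq Jⱼ))
    ... | inj₁ (i≤a , Jᵢ) | inj₂ (t , t≤b , _ , Jⱼ) =
      contradiction (trans (sym Jᵢ) (trans eq Jⱼ)) (disjoint i≤a t≤b)
    ... | inj₂ (t , t≤b , _ , Jᵢ) | inj₁ (j≤a , Jⱼ) =
      contradiction (trans (sym Jⱼ) (trans (sym eq) Jᵢ)) (disjoint j≤a t≤b)
    ... | inj₂ (t , t≤b , refl , Jᵢ) | inj₂ (t' , t'≤b , refl , Jⱼ) =
      cong (suc a +_) (injective Q t≤b t'≤b (trans (sym Jᵢ) (trans eq Jⱼ)))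

    joined-adjacent : ∀ {i} → i < a + suc b → A (joined i) (joined (suc i)) ≡ true
    joined-adjacent {i} i< with ≤-or-beyond a i
    ... | inj₂ (t , refl) =
      subst₂ (λ x y → A x y ≡ true) (sym (join-right _ _ a t))
        (sym (trans (cong joined (sym (+-suc (suc a) t))) (join-right _ _ a (suc t))))
        (adjacent Q (right-bound (subst (_≤ a + suc b) (sym (cong suc (+-suc a t))) i<)))
    ... | inj₁ i≤a with m≤n⇒m<n∨m≡n i≤a
    ...   | inj₁ i<a = subst₂ (λ x y → A x y ≡ true)
                         (sym (join-left _ _ a i≤a)) (sym (join-left _ _ a i<a)) (adjacent P i<a)
    ...   | inj₂ refl = subst₂ (λ x y → A x y ≡ true) (sym (join-left _ _ a i≤a))
                          (sym (trans (cong joined (sym (+-identityʳ (suc a)))) (join-right _ _ a 0))) link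

  append : ℕPath A (a + suc b)
  append = record { vertex = joined ; injective = joined-injective ; adjacent = joined-adjacent }

  append-first : append ! 0 ≡ P ! 0
  append-first = join-left (vertex P) (vertex Q) a z≤n

  append-last : append ! (a + suc b) ≡ Q ! b
  append-last = trans (cong joined (+-suc a b)) (join-right (vertex P) (vertex Q) a b)

  append-all : ∀ {D : Fin n → Set} → AllVertices D P → AllVertices D Q → AllVertices D append
  append-all {D} allP allQ i≤ with joined-cases i≤
  ... | inj₁ (i≤a , eq)          = subst D (sym eq) (allP i≤a)
  ... | inj₂ (t , t≤b , _ , eq)  = subst D (sym eq) (allQ t≤b)

-- clamp r i = min i r, so that a Fin-indexed path can be read at every ℕ index.
clamp : (r : ℕ) → ℕ → Fin (suc r)
clamp zero    _       = zero
clamp (suc r) zero    = zero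
clamp (suc r) (suc i) = suc (clamp r i)

toℕ-clamp : ∀ {r i} → i ≤ r → toℕ (clamp r i) ≡ i
toℕ-clamp {zero}  z≤n       = refl
toℕ-clamp {suc r} z≤n       = refl
toℕ-clamp {suc r} (s≤s i≤r) = cong suc (toℕ-clamp i≤r)

clamp-zero : ∀ r → clamp r 0 ≡ zero
clamp-zero zero    = refl
clamp-zero (suc r) = refl

clamp-last : ∀ r → clamp r r ≡ fromℕ r
clamp-last zero    = refl
clamp-last (suc r) = cong suc (clamp-last r)

inject₁-clamp : ∀ {r i} → i ≤ r → inject₁ (clamp r i) ≡ clamp (suc r) i
inject₁-clamp {zero}  z≤n       = refl
inject₁-clamp {suc r} z≤n       = refl
inject₁-clamp {suc r} (s≤s i≤r) = cong suc (inject₁-clamp i≤r)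

module _ {n : ℕ} {A : Adjacency n} where

  fromPath : ∀ {r} → Path A r → ℕPath A r
  fromPath {r} P = record
    { vertex    = vtx P ∘ clamp r
    ; injective = λ {i} {j} i≤r j≤r eq →
        trans (sym (toℕ-clamp i≤r)) (trans (cong toℕ (distinct P eq)) (toℕ-clamp j≤r))
    ; adjacent  = step
    }
    where
    step : ∀ {i} → i < r → A (vtx P (clamp r i)) (vtx P (clamp r (suc i))) ≡ true
    step {i} (s≤s i≤r') = subst (λ j → A (vtx P j) (vtx P (suc (clamp _ i))) ≡ true)
                            (inject₁-clamp i≤r') (edges P (clamp _ i))

  toPath : ∀ {L} → ℕPath A L → Path A L
  toPath P = record
    { vtx      = λ i → P ! toℕ i
    ; distinct = λ {i} {j} eq → toℕ-injective (injective P (≤-pred (toℕ<n i)) (≤-pred (toℕ<n j)) eq)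
    ; edges    = λ i → subst (λ m → A (P ! m) (P ! suc (toℕ i)) ≡ true)
                           (sym (toℕ-inject₁ i)) (adjacent P (toℕ<n i))
    }

  start-fromPath : ∀ {r} (P : Path A r) → fromPath P ! 0 ≡ start P
  start-fromPath {r} P = cong (vtx P) (clamp-zero r)

  end-fromPath : ∀ {r} (P : Path A r) → fromPath P ! r ≡ end P
  end-fromPath {r} P = cong (vtx P) (clamp-last r)

  end-toPath : ∀ {L} (P : ℕPath A L) → end (toPath P) ≡ P ! L
  end-toPath {L} P = cong (vertex P) (toℕ-fromℕ L)

SameEdge : ∀ {X : Set} → X → X → X → X → Set
SameEdge a b x y = (a ≡ x × b ≡ y) ⊎ (a ≡ y × b ≡ x)

same-edge-trans : ∀ {X : Set} {a b p q x y : X} → SameEdge a b x y → SameEdge p q x y → SameEdge a b p q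
same-edge-trans (inj₁ (a≡x , b≡y)) (inj₁ (p≡x , q≡y)) = inj₁ (trans a≡x (sym p≡x) , trans b≡y (sym q≡y))
same-edge-trans (inj₁ (a≡x , b≡y)) (inj₂ (p≡y , q≡x)) = inj₂ (trans a≡x (sym q≡x) , trans b≡y (sym p≡y))
same-edge-trans (inj₂ (a≡y , b≡x)) (inj₁ (p≡x , q≡y)) = inj₂ (trans a≡y (sym q≡y) , trans b≡x (sym p≡x))
same-edge-trans (inj₂ (a≡y , b≡x)) (inj₂ (p≡y , q≡x)) = inj₁ (trans a≡y (sym p≡y) , trans b≡x (sym q≡x))

same-edge-swap : ∀ {X : Set} {a b x y : X} → SameEdge a b x y → SameEdge b a x y
same-edge-swap = Sum.swap ∘ Sum.map Prod.swap Prod.swap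

module _ {n : ℕ} {A B : Adjacency n} {m : ℕ} (c : ℕPath B m) where

  rotate : ∀ {i} → i < m → (∀ {j} → j < m → j ≢ i → A (c ! j) (c ! suc j) ≡ true) →
    A (c ! m) (c ! 0) ≡ true → Σ (ℕPath A m) λ R → R ! 0 ≡ c ! suc i × R ! m ≡ c ! i
  rotate {i} i<m other closing = cast a+1+i≡m R , first , last
    where
    a = m ∸ suc i
    1+i+a≡m : suc i + a ≡ m
    1+i+a≡m = m+[n∸m]≡n i<m
    a+1+i≡m : a + suc i ≡ m
    a+1+i≡m = trans (+-comm a (suc i)) 1+i+a≡m
    after : ℕPath A a
    after = restrict (segment c (suc i) a (≤-reflexive 1+i+a≡m))
      λ {t} t<a → subst (λ j → A (c ! (suc i + t)) (c ! j) ≡ true) (sym (+-suc (suc i) t))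
        (other (subst (_≤ m) (+-suc (suc i) t) (≤-trans (+-monoʳ-≤ (suc i) t<a) (≤-reflexive 1+i+a≡m)))
               (m≢1+m+n i ∘ sym))
    before : ℕPath A i
    before = restrict (segment c 0 i (<⇒≤ i<m)) λ t<i → other (<-trans t<i i<m) (<⇒≢ t<i)
    link : A (after ! a) (before ! 0) ≡ true
    link = subst (λ j → A (c ! j) (c ! 0) ≡ true) (sym 1+i+a≡m) closing
    disjoint : ∀ {p q} → p ≤ a → q ≤ i → after ! p ≢ before ! q
    disjoint {p} {q} p≤a q≤i eq = <⇒≢ (s≤s (≤-trans q≤i (m≤m+n i p))) (sym (injective c
      (≤-trans (+-monoʳ-≤ (suc i) p≤a) (≤-reflexive 1+i+a≡m)) (≤-trans q≤i (<⇒≤ i<m)) eq))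
    R = append after before link disjoint
    first : R ! 0 ≡ c ! suc i
    first = trans (append-first after before link disjoint) (cong (c !_) (+-identityʳ (suc i)))
    last : R ! m ≡ c ! i
    last = trans (cong (R !_) (sym a+1+i≡m)) (append-last after before link disjoint)

module _ {n : ℕ} {A : Adjacency n} {x y : Fin n} where

  addEdge-edge : ∀ a b → addEdge A x y a b ≡ true → A a b ≡ true ⊎ SameEdge a b x y
  addEdge-edge a b h =
    Sum.map (T-≡ .to)
      (Sum.map (witnesses (a ≟ x) (b ≟ y)) (witnesses (a ≟ y) (b ≟ x)) ∘ T-∨ .to)
      (T-∨ .to (T-≡ .from h))
    where
    witnesses : ∀ {P Q : Set} (p? : Dec P) (q? : Dec Q) → T (⌊ p? ⌋ ∧ ⌊ q? ⌋) → P × Q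
    witnesses p? q? t = let p , q = T-∧ {⌊ p? ⌋} .to t in toWitness {a? = p?} p , toWitness {a? = q?} q

  -- As A has no closed path of length m, the closed path c uses the new edge xy, and only once
  -- since c is injective; rotating c so that xy becomes the closing edge leaves a path in A.
  path-from-closed-path : ∀ {m} → 2 ≤ m → (∀ (P : ℕPath A m) → ¬ A (P ! m) (P ! 0) ≡ true) →
    (c : ℕPath (addEdge A x y) m) → addEdge A x y (c ! m) (c ! 0) ≡ true →
    Σ (ℕPath A m) λ P → SameEdge (P ! 0) (P ! m) x y
  path-from-closed-path {m} 2≤m acyclic c closing
    with anyUpTo? (λ j → A (c ! j) (c ! suc j) ≟ᵇ false) m
  ... | no none = P , same-edge-swap ([ ⊥-elim ∘ acyclic P , id ]′ (addEdge-edge _ _ closing))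
    where
    P = restrict c λ j<m → ¬-not λ notA → none (_ , j<m , notA)
  ... | yes (i , i<m , notA) =
    let R , R₀ , Rₘ = rotate c i<m other closingᴬ
    in  R , subst₂ (λ a b → SameEdge a b x y) (sym R₀) (sym Rₘ) (same-edge-swap newᵢ)
    where
    newᵢ : SameEdge (c ! i) (c ! suc i) x y
    newᵢ = [ (λ inA → contradiction (trans (sym notA) inA) λ ()) , id ]′ (addEdge-edge _ _ (adjacent c i<m))
    same-as-newᵢ : ∀ {p q} → p ≤ m → q ≤ m → SameEdge (c ! p) (c ! q) x y → SameEdge p q i (suc i)
    same-as-newᵢ p≤m q≤m new = Sum.map (Prod.map (injective c p≤m (<⇒≤ i<m)) (injective c q≤m i<m))
                                       (Prod.map (injective c p≤m i<m) (injective c q≤m (<⇒≤ i<m)))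
                                       (same-edge-trans new newᵢ)
    other : ∀ {j} → j < m → j ≢ i → A (c ! j) (c ! suc j) ≡ true
    other {j} j<m j≢i =
      [ id , (λ newⱼ → case (same-as-newᵢ (<⇒≤ j<m) j<m newⱼ)) ]′ (addEdge-edge _ _ (adjacent c j<m))
      where
      case : SameEdge j (suc j) i (suc i) → A (c ! j) (c ! suc j) ≡ true
      case (inj₁ (j≡i , _))      = contradiction j≡i j≢i
      case (inj₂ (refl , 2+i≡i)) = contradiction 2+i≡i (m≢1+n+m i ∘ sym)
    closingᴬ : A (c ! m) (c ! 0) ≡ true
    closingᴬ = [ id , (λ new → case (same-as-newᵢ ≤-refl z≤n new)) ]′ (addEdge-edge _ _ closing)
      where
      case : SameEdge m 0 i (suc i) → A (c ! m) (c ! 0) ≡ true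
      case (inj₁ (_ , ()))
      case (inj₂ (refl , refl)) = contradiction 2≤m λ { (s≤s ()) }

module _ {X : Set} where

  2≤length : ∀ {xs : List X} {y z} → y ∈ xs → z ∈ xs → y ≢ z → 2 ≤ length xs
  2≤length (here refl) (here refl) y≢z = contradiction refl y≢z
  2≤length (here _)    (there z∈)  _   = s≤s (∈-length z∈)
  2≤length (there y∈)  (here _)    _   = s≤s (∈-length y∈)
  2≤length (there y∈)  (there z∈)  y≢z = m≤n⇒m≤1+n (2≤length y∈ z∈ y≢z)

  3≤length : ∀ {xs : List X} {x y z} → x ∈ xs → y ∈ xs → z ∈ xs → x ≢ y → x ≢ z → y ≢ z → 3 ≤ length xs
  3≤length (here refl) (here refl) _           x≢y _   _   = contradiction refl x≢y
  3≤length (here refl) _           (here refl) _   x≢z _   = contradiction refl x≢z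
  3≤length _           (here refl) (here refl) _   _   y≢z = contradiction refl y≢z
  3≤length (here _)    (there y∈)  (there z∈)  _   _   y≢z = s≤s (2≤length y∈ z∈ y≢z)
  3≤length (there x∈)  (here _)    (there z∈)  _   x≢z _   = s≤s (2≤length x∈ z∈ x≢z)
  3≤length (there x∈)  (there y∈)  (here _)    x≢y _   _   = s≤s (2≤length x∈ y∈ x≢y)
  3≤length (there x∈)  (there y∈)  (there z∈)  x≢y x≢z y≢z = m≤n⇒m≤1+n (3≤length x∈ y∈ z∈ x≢y x≢z y≢z)

module GraphFacts {n : ℕ} (G : Graph n) where

  Edge : Fin n → Fin n → Set
  Edge x y = adj G x y ≡ true

  DegreeTwo : Fin n → Set
  DegreeTwo x = degree G x ≡ 2

  AllDegreeTwo : ∀ {m} → ℕPath (adj G) m → Set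
  AllDegreeTwo = AllVertices DegreeTwo

  edge-sym : ∀ {x y} → Edge x y → Edge y x
  edge-sym {x} {y} = trans (Graph.sym G y x)

  degree-two-neighbours : ∀ {x y z t} → DegreeTwo x → Edge x y → Edge x z → y ≢ z →
    Edge x t → t ≡ y ⊎ t ≡ z
  degree-two-neighbours {x} {y} {z} {t} deg xy xz y≢z xt with t ≟ y | t ≟ z
  ... | yes t≡y | _       = inj₁ t≡y
  ... | no _    | yes t≡z = inj₂ t≡z
  ... | no t≢y  | no t≢z  = contradiction (subst (3 ≤_) deg
          (3≤length (neighbour xy) (neighbour xz) (neighbour xt) y≢z (t≢y ∘ sym) (t≢z ∘ sym))) (n≮n 2)
    where
    neighbour : ∀ {v} → Edge x v → v ∈ filter (λ v → adj G x v ≟ᵇ true) (allFin n)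
    neighbour {v} e = ∈-filter⁺ _ (∈-allFin v) e

  reverse : ∀ {L} → ℕPath (adj G) L → ℕPath (adj G) L
  reverse {L} P = record
    { vertex    = λ i → P ! (L ∸ i)
    ; injective = λ {i} {j} i≤L j≤L eq → ∸-cancelˡ-≡ i≤L j≤L (injective P (m∸n≤m L i) (m∸n≤m L j) eq)
    ; adjacent  = λ {i} i<L → edge-sym (subst (λ m → Edge (P ! (L ∸ suc i)) (P ! m))
                    (sym (+-∸-assoc 1 i<L)) (adjacent P (subst (_≤ L) (+-∸-assoc 1 i<L) (m∸n≤m L i))))
    }

  orient : ∀ {L x y} (P : ℕPath (adj G) L) → SameEdge (P ! 0) (P ! L) x y →
    Σ (ℕPath (adj G) L) λ Q → Q ! 0 ≡ x × Q ! L ≡ y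
  orient P (inj₁ (P₀ , Pₗ)) = P , P₀ , Pₗ
  orient {L} P (inj₂ (P₀ , Pₗ)) = reverse P , Pₗ , trans (cong (P !_) (n∸n≡0 L)) P₀

  interior-neighbours : ∀ {m i t} (c : ℕPath (adj G) m) → suc i < m → DegreeTwo (c ! suc i) →
    Edge (c ! suc i) t → t ≡ c ! i ⊎ t ≡ c ! suc (suc i)
  interior-neighbours {i = i} c i+1<m deg =
    degree-two-neighbours deg (edge-sym (adjacent c (<⇒≤ i+1<m))) (adjacent c i+1<m)
      (!-distinct c (≤-trans (m≤n+m i 2) i+1<m) i+1<m (m≢1+n+m i))

  follow : ∀ {m L} (c : ℕPath (adj G) m) (P : ℕPath (adj G) L) →
    (∀ {i} → 0 < i → i < m → DegreeTwo (c ! i)) →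
    P ! 0 ≡ c ! 0 → P ! 1 ≡ c ! 1 → ∀ {i} → i ≤ L → i ≤ m → P ! i ≡ c ! i
  follow {m} {L} c P interior P₀ P₁ {zero}  _   _   = P₀
  follow {m} {L} c P interior P₀ P₁ {suc i} i<L i<m = proj₂ (agree i i<L i<m)
    where
    agree : ∀ i → suc i ≤ L → suc i ≤ m → P ! i ≡ c ! i × P ! suc i ≡ c ! suc i
    agree zero    _     _     = P₀ , P₁
    agree (suc i) i+1<L i+1<m with agree i (<⇒≤ i+1<L) (<⇒≤ i+1<m)
    ... | Pᵢ , Pᵢ₊₁ with interior-neighbours c i+1<m (interior z<s i+1<m)
                           (subst (λ x → Edge x (P ! suc (suc i))) Pᵢ₊₁ (adjacent P i+1<L))
    ...   | inj₁ back = contradiction (trans Pᵢ (sym back))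
                          (!-distinct P (≤-trans (m≤n+m i 2) i+1<L) i+1<L (m≢1+n+m i))
    ...   | inj₂ forward = Pᵢ₊₁ , forward

  follow-reversed : ∀ {m L j l} (c : ℕPath (adj G) m) (P : ℕPath (adj G) (suc L)) →
    AllDegreeTwo c → j + l ≤ m → P ! suc L ≡ c ! j → P ! L ≡ c ! (j + 1) →
    ∀ {t} → t ≤ suc L → t ≤ l → P ! (suc L ∸ t) ≡ c ! (j + t)
  follow-reversed {j = j} c P deg j+l≤m Pₗ₊₁ Pₗ =
    follow (segment c j _ j+l≤m) (reverse P) (λ {i} _ i<l → deg (≤-trans (+-monoʳ-≤ j (<⇒≤ i<l)) j+l≤m))
      (trans Pₗ₊₁ (cong (c !_) (sym (+-identityʳ j)))) Pₗ

  -- Reversed, P runs along c from c_{j+1} down to c₀ = P₀, which forces it to be short.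
  backward-entry : ∀ {m L j} (c : ℕPath (adj G) m) (P : ℕPath (adj G) (suc L)) →
    AllDegreeTwo c → suc j ≤ m → P ! 0 ≡ c ! 0 → P ! suc L ≡ c ! suc j → P ! L ≡ c ! j → L ≤ j
  backward-entry {m} {L} {j} c P deg j<m P₀ Pₗ₊₁ Pₗ with L ≤? j
  ... | yes L≤j = L≤j
  ... | no  L≰j = contradiction (injective P (m∸n≤m (suc L) (suc j)) z≤n (trans along (sym P₀)))
                                (m>n⇒m∸n≢0 (s≤s (≰⇒> L≰j)))
    where
    along : P ! (L ∸ j) ≡ c ! 0
    along = trans (follow (reverse (segment c 0 (suc j) j<m)) (reverse P)
                    (λ {i} _ _ → deg (≤-trans (m∸n≤m (suc j) i) j<m)) Pₗ₊₁ Pₗ (s≤s (<⇒≤ (≰⇒> L≰j))) ≤-refl)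
                  (cong (c !_) (n∸n≡0 (suc j)))

module Saturation {n : ℕ} (G : Graph n) (k' : ℕ) (saturated : Saturated (5 + k') G) where

  open GraphFacts G public

  -- K = k − 1 is the length of the paths that saturation provides.
  K : ℕ
  K = 4 + k'

  no-closed-path : (P : ℕPath (adj G) K) → ¬ Edge (P ! K) (P ! 0)
  no-closed-path P closing =
    proj₁ saturated (m≤m+n 3 _ , toPath P , subst (λ v → Edge v (P ! 0)) (sym (end-toPath P)) closing)

  record Joining (x y : Fin n) : Set where
    field
      path  : ℕPath (adj G) K
      first : path ! 0 ≡ x
      last  : path ! K ≡ y

  saturated-path : ∀ {x y} → x ≢ y → ¬ Edge x y → Joining x y
  saturated-path {x} {y} x≢y ¬xy with proj₂ saturated x y x≢y (¬-not ¬xy)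
  ... | _ , C , closing =
    let P , ends = path-from-closed-path (m≤m+n 2 _) no-closed-path (fromPath C) closing′
        Q , Q₀ , Qₖ = orient P ends
    in  record { path = Q ; first = Q₀ ; last = Qₖ }
    where
    closing′ : addEdge (adj G) x y (fromPath C ! K) (fromPath C ! 0) ≡ true
    closing′ = subst₂ (λ a b → addEdge (adj G) x y a b ≡ true)
                 (sym (end-fromPath C)) (sym (start-fromPath C)) closing

  -- The saturation path from c₀ to c₃ can neither start along c, nor end along c (by c₂ or c₄).
  ends-have-no-common-neighbour : ∀ {x} (c : ℕPath (adj G) K) → AllDegreeTwo c →
    (∀ {i} → i ≤ K → x ≢ c ! i) → Edge x (c ! 0) → ¬ Edge x (c ! K)
  ends-have-no-common-neighbour {x} c deg off x~c₀ x~cₖ =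
    second-vertex (neighbours₀ (subst (λ v → Edge v (P ! 1)) P₀ (adjacent P (m≤m+n 1 _))))
    where
    neighbours₀ : ∀ {t} → Edge (c ! 0) t → t ≡ x ⊎ t ≡ c ! 1
    neighbours₀ = degree-two-neighbours (deg z≤n) (edge-sym x~c₀) (adjacent c (m≤m+n 1 _)) (off (m≤m+n 1 _))
    c₀≁c₃ : ¬ Edge (c ! 0) (c ! 3)
    c₀≁c₃ e = [ off (m≤m+n 3 _) ∘ sym , !-distinct c (m≤m+n 3 _) (m≤m+n 1 _) (λ ()) ]′ (neighbours₀ e)
    open Joining (saturated-path (!-distinct c z≤n (m≤m+n 3 _) (λ ())) c₀≁c₃)
      renaming (path to P; first to P₀; last to Pₖ)
    second-vertex : P ! 1 ≡ x ⊎ P ! 1 ≡ c ! 1 → ⊥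
    second-vertex (inj₂ P₁≡c₁) = !-distinct P (m≤m+n 3 _) ≤-refl (λ ())
      (trans (follow c P (λ _ i<K → deg (<⇒≤ i<K)) P₀ P₁≡c₁ (m≤m+n 3 _) (m≤m+n 3 _)) (sym Pₖ))
    second-vertex (inj₁ P₁≡x) = second-last (interior-neighbours c (m≤m+n 4 _) (deg (m≤m+n 3 _))
                                    (edge-sym (subst (Edge (P ! (3 + k'))) Pₖ (adjacent P ≤-refl))))
      where
      second-last : P ! (3 + k') ≡ c ! 2 ⊎ P ! (3 + k') ≡ c ! 4 → ⊥
      second-last (inj₁ Pₖ₋₁≡c₂) =
        contradiction (backward-entry c P deg (m≤m+n 3 _) P₀ Pₖ Pₖ₋₁≡c₂) λ { (s≤s (s≤s ())) }
      second-last (inj₂ Pₖ₋₁≡c₄) =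
        [ (λ P₂≡cₖ₋₁ → !-distinct P (m≤m+n 2 _) (m≤m+n 4 _) (λ ()) (trans P₂≡cₖ₋₁ (sym P₄)))
        , (λ P₂≡x → !-distinct P (m≤m+n 2 _) (m≤m+n 1 _) (λ ()) (trans P₂≡x (sym P₁≡x)))
        ]′ (neighboursₖ (edge-sym (subst (Edge (P ! 2)) P₃ (adjacent P (m≤m+n 3 _)))))
        where
        along : ∀ {t} → t ≤ K → t ≤ 1 + k' → P ! (K ∸ t) ≡ c ! (3 + t)
        along = follow-reversed c P deg ≤-refl Pₖ Pₖ₋₁≡c₄
        P₃ : P ! 3 ≡ c ! K
        P₃ = trans (cong (P !_) (sym (m+n∸n≡m 3 (1 + k')))) (along (m≤n+m _ 3) ≤-refl)
        P₄ : P ! 4 ≡ c ! (3 + k')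
        P₄ = trans (cong (P !_) (sym (m+n∸n≡m 4 k'))) (along (m≤n+m _ 4) (n≤1+n k'))
        neighboursₖ : ∀ {t} → Edge (c ! K) t → t ≡ c ! (3 + k') ⊎ t ≡ x
        neighboursₖ = degree-two-neighbours (deg ≤-refl) (edge-sym (adjacent c ≤-refl)) (edge-sym x~cₖ)
                        (off (n≤1+n _) ∘ sym)

  -- The saturation path from c₀ to c₂ must end along c from c_K, so its second vertex is a
  -- common neighbour of c₀ and c_K off c.
  no-degree-two-path : (c : ℕPath (adj G) K) → ¬ AllDegreeTwo c
  no-degree-two-path c deg =
    second-last (interior-neighbours c (m≤m+n 3 _) (deg (m≤m+n 2 _))
                  (edge-sym (subst (Edge (P ! (3 + k'))) Pₖ (adjacent P ≤-refl))))
    where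
    c₀≁c₂ : ¬ Edge (c ! 0) (c ! 2)
    c₀≁c₂ e = [ !-distinct c z≤n (m≤m+n 1 _) (λ ()) , !-distinct c z≤n (m≤m+n 3 _) (λ ()) ]′
                (interior-neighbours c (m≤m+n 3 _) (deg (m≤m+n 2 _)) (edge-sym e))
    open Joining (saturated-path (!-distinct c z≤n (m≤m+n 2 _) (λ ())) c₀≁c₂)
      renaming (path to P; first to P₀; last to Pₖ)
    second-last : P ! (3 + k') ≡ c ! 1 ⊎ P ! (3 + k') ≡ c ! 3 → ⊥
    second-last (inj₁ Pₖ₋₁≡c₁) =
      contradiction (backward-entry c P deg (m≤m+n 2 _) P₀ Pₖ Pₖ₋₁≡c₁) λ { (s≤s ()) }
    second-last (inj₂ Pₖ₋₁≡c₃) = ends-have-no-common-neighbour c deg off x~c₀ x~cₖ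
      where
      along : ∀ {t} → t ≤ K → t ≤ 2 + k' → P ! (K ∸ t) ≡ c ! (2 + t)
      along = follow-reversed c P deg ≤-refl Pₖ Pₖ₋₁≡c₃
      x = P ! 1
      x~c₀ : Edge x (c ! 0)
      x~c₀ = edge-sym (subst (λ v → Edge v x) P₀ (adjacent P (m≤m+n 1 _)))
      P₂ : P ! 2 ≡ c ! K
      P₂ = trans (cong (P !_) (sym (m+n∸n≡m 2 (2 + k')))) (along (m≤n+m _ 2) ≤-refl)
      x~cₖ : Edge x (c ! K)
      x~cₖ = subst (Edge x) P₂ (adjacent P (m≤m+n 2 _))
      off : ∀ {i} → i ≤ K → x ≢ c ! i
      off {0} _ x≡c₀ = !-distinct P (m≤m+n 1 _) z≤n (λ ()) (trans x≡c₀ (sym P₀))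
      off {1} _ x≡c₁ =
        [ !-distinct c ≤-refl z≤n (λ ()) , !-distinct c ≤-refl (m≤m+n 2 _) (λ ()) ]′
          (interior-neighbours c (m≤m+n 2 _) (deg (m≤m+n 1 _)) (subst (λ v → Edge v (c ! K)) x≡c₁ x~cₖ))
      off {suc (suc j)} j+2≤K x≡cⱼ₊₂ = <⇒≢ (≤-trans (≤-reflexive (sym (m+n∸n≡m 2 (2 + k')))) (∸-monoʳ-≤ K j≤))
        (injective P (m≤m+n 1 _) (m∸n≤m K j) (trans x≡cⱼ₊₂ (sym (along (≤-trans j≤ (m≤n+m _ 2)) j≤))))
        where
        j≤ : j ≤ 2 + k'
        j≤ = ≤-pred (≤-pred j+2≤K)

  degree-two-path-shorter : ∀ {m} (c : ℕPath (adj G) m) → AllDegreeTwo c → m < K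
  degree-two-path-shorter {m} c deg with K ≤? m
  ... | no  K≰m = ≰⇒> K≰m
  ... | yes K≤m = contradiction (λ {i} i≤K → deg (≤-trans i≤K K≤m)) (no-degree-two-path (segment c 0 K K≤m))

  second-vertex-not-adjacent : ∀ {r s} (u : ℕPath (adj G) r) (v : ℕPath (adj G) s) →
    (∀ {i j} → i ≤ r → j ≤ s → u ! i ≢ v ! j) → AllDegreeTwo u → AllDegreeTwo v →
    K ≤ r + s → 1 ≤ r → ¬ Edge (u ! 1) (v ! 0)
  second-vertex-not-adjacent {r} {s} u v disjoint deg-u deg-v long 1≤r u₁~v₀ with 2 ≤? r
  ... | yes 2≤r = [ disjoint z≤n z≤n ∘ sym , disjoint 2≤r z≤n ∘ sym ]′
                    (interior-neighbours u 2≤r (deg-u 1≤r) u₁~v₀)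
  -- For r = 1, v reversed and then u₁ would be a degree-two path of length s + 1 ≥ K.
  ... | no  2≰r = <⇒≱ (degree-two-path-shorter chain chain-deg)
                     (subst (K ≤_) (trans (cong (_+ s) r≡1) (+-comm 1 s)) long)
    where
    r≡1 : r ≡ 1
    r≡1 = ≤-antisym (≤-pred (≰⇒> 2≰r)) 1≤r
    link : Edge (reverse v ! s) (u ! 1)
    link = edge-sym (subst (λ i → Edge (u ! 1) (v ! i)) (sym (n∸n≡0 s)) u₁~v₀)
    u₁ : ℕPath (adj G) 0
    u₁ = single (u ! 1)
    apart : ∀ {i j} → i ≤ s → j ≤ 0 → reverse v ! i ≢ u₁ ! j
    apart {i} _ _ eq = disjoint 1≤r (m∸n≤m s i) (sym eq)
    chain = append (reverse v) u₁ link apart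
    chain-deg : AllDegreeTwo chain
    chain-deg = append-all (reverse v) u₁ link apart {DegreeTwo}
                  (λ {i} _ → deg-v (m∸n≤m s i)) (λ _ → deg-u 1≤r)

  module _ {r s} (u : ℕPath (adj G) r) (v : ℕPath (adj G) s)
           (disjoint : ∀ {i j} → i ≤ r → j ≤ s → u ! i ≢ v ! j)
           (deg-u : AllDegreeTwo u) (deg-v : AllDegreeTwo v) (long : K ≤ r + s)
           {w} (w~u₀ : Edge w (u ! 0)) (w~v₀ : Edge w (v ! 0)) where

    private
      r<K : r < K
      r<K = degree-two-path-shorter u deg-u

      s<K : s < K
      s<K = degree-two-path-shorter v deg-v

      long′ : K ≤ s + r
      long′ = subst (K ≤_) (+-comm r s) long

      positive : ∀ {a b} → K ≤ a + b → b < K → 1 ≤ a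
      positive {zero}  K≤b b<K = contradiction K≤b (<⇒≱ b<K)
      positive {suc a} _   _   = s≤s z≤n

      1≤r : 1 ≤ r
      1≤r = positive long s<K

      1≤s : 1 ≤ s
      1≤s = positive long′ r<K

      w≢u₁ : w ≢ u ! 1
      w≢u₁ w≡u₁ = second-vertex-not-adjacent u v disjoint deg-u deg-v long 1≤r
                    (subst (λ x → Edge x (v ! 0)) w≡u₁ w~v₀)

      w≢v₁ : w ≢ v ! 1
      w≢v₁ w≡v₁ = second-vertex-not-adjacent v u (λ j≤s i≤r → disjoint i≤r j≤s ∘ sym) deg-v deg-u
                    long′ 1≤s (subst (λ x → Edge x (u ! 0)) w≡v₁ w~u₀)

      neighbours-u₀ : ∀ {t} → Edge (u ! 0) t → t ≡ w ⊎ t ≡ u ! 1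
      neighbours-u₀ = degree-two-neighbours (deg-u z≤n) (edge-sym w~u₀) (adjacent u 1≤r) w≢u₁

      neighbours-v₀ : ∀ {t} → Edge (v ! 0) t → t ≡ w ⊎ t ≡ v ! 1
      neighbours-v₀ = degree-two-neighbours (deg-v z≤n) (edge-sym w~v₀) (adjacent v 1≤s) w≢v₁

      u₀≁v₁ : ¬ Edge (u ! 0) (v ! 1)
      u₀≁v₁ e = [ w≢v₁ ∘ sym , disjoint 1≤r 1≤s ∘ sym ]′ (neighbours-u₀ e)

    open Joining (saturated-path (disjoint z≤n 1≤s) u₀≁v₁) renaming (path to P; first to P₀; last to Pₖ)

    private

      second : P ! 1 ≡ w ⊎ P ! 1 ≡ u ! 1
      second = neighbours-u₀ (subst (λ x → Edge x (P ! 1)) P₀ (adjacent P (m≤m+n 1 _)))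

      along-u : P ! 1 ≡ u ! 1 → ∀ {i} → i ≤ r → P ! i ≡ u ! i
      along-u P₁≡u₁ i≤r = follow u P (λ _ i<r → deg-u (<⇒≤ i<r)) P₀ P₁≡u₁ (≤-trans i≤r (<⇒≤ r<K)) i≤r

      -- v₀ w P₂ … P_K = v₁ would be a C_k.
      through-w : P ! 1 ≡ w → P ! (3 + k') ≢ v ! 0 → ⊥
      through-w P₁≡w Pₖ₋₁≢v₀ =
        no-closed-path cycle (subst (λ x → Edge x (v ! 0)) (sym Pₖ) (edge-sym (adjacent v 1≤s)))
        where
        v₀ : ℕPath (adj G) 0
        v₀ = single (v ! 0)
        rest = segment P 1 (3 + k') ≤-refl
        off : ∀ {i} → suc i ≤ K → P ! suc i ≢ v ! 0
        off {i} i<K e = [ inner , last ]′ (m≤n⇒m<n∨m≡n i<K)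
          where
          last : suc i ≡ K → ⊥
          last i+1≡K = !-distinct v 1≤s z≤n (λ ()) (trans (sym Pₖ) (subst (λ j → P ! j ≡ v ! 0) i+1≡K e))
          inner : suc i < K → ⊥
          inner i+1<K =
            [ (λ P≡w → !-distinct P i+1<K (m≤m+n 1 _) (λ ()) (trans P≡w (sym P₁≡w)))
            , (λ P≡v₁ → Pₖ₋₁≢v₀ (subst (λ j → P ! j ≡ v ! 0)
                           (suc-injective (injective P i+1<K ≤-refl (trans P≡v₁ (sym Pₖ)))) e))
            ]′ (neighbours-v₀ (subst (λ x → Edge x (P ! suc (suc i))) e (adjacent P i+1<K)))
        link : Edge (v₀ ! 0) (rest ! 0)
        link = subst (Edge (v ! 0)) (sym P₁≡w) (edge-sym w~v₀)
        apart : ∀ {i j} → i ≤ 0 → j ≤ 3 + k' → v₀ ! i ≢ rest ! j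
        apart _ j≤ e = off (s≤s j≤) (sym e)
        cycle = append v₀ rest link apart

      along-v : P ! (3 + k') ≢ v ! 0 → ∀ {t} → t ≤ K → suc t ≤ s → P ! (K ∸ t) ≡ v ! suc t
      along-v _        {zero}  _   _     = Pₖ
      along-v Pₖ₋₁≢v₀ {suc t} t<K t+1<s =
        follow-reversed v P deg-v (≤-reflexive (m+[n∸m]≡n 1≤s)) Pₖ Pₖ₋₁≡v₂ t<K (∸-monoˡ-≤ 1 t+1<s)
        where
        Pₖ₋₁≡v₂ : P ! (3 + k') ≡ v ! 2
        Pₖ₋₁≡v₂ = [ ⊥-elim ∘ Pₖ₋₁≢v₀ , id ]′
                    (interior-neighbours v (≤-trans (m≤m+n 2 t) t+1<s) (deg-v 1≤s)
                      (edge-sym (subst (Edge (P ! (3 + k'))) Pₖ (adjacent P ≤-refl))))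

      -- P runs along u from u₀ and backwards along v from v₁: u and v meet unless r + s = K,
      -- and then every vertex of P has degree two.
      through-u₁ : P ! 1 ≡ u ! 1 → P ! (3 + k') ≢ v ! 0 → ⊥
      through-u₁ P₁≡u₁ Pₖ₋₁≢v₀ = [ u-meets-v , all-degree-two ]′ (m≤n⇒m<n∨m≡n long)
        where
        u-meets-v : K < r + s → ⊥
        u-meets-v K<r+s = disjoint ≤-refl t<s (trans (sym (along-u P₁≡u₁ ≤-refl))
                          (trans (cong (P !_) (sym (m∸[m∸n]≡n (<⇒≤ r<K)))) (along-v Pₖ₋₁≢v₀ (m∸n≤m K r) t<s)))
          where
          t<s : suc (K ∸ r) ≤ s
          t<s = subst (suc (K ∸ r) ≤_) (m+n∸m≡n r s) (∸-monoˡ-< K<r+s (<⇒≤ r<K))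
        all-degree-two : K ≡ r + s → ⊥
        all-degree-two K≡r+s = no-degree-two-path P λ {i} i≤K → [ on-u , on-v i≤K ]′ (≤-<-connex i r)
          where
          on-u : ∀ {i} → i ≤ r → DegreeTwo (P ! i)
          on-u i≤r = subst DegreeTwo (sym (along-u P₁≡u₁ i≤r)) (deg-u i≤r)
          on-v : ∀ {i} → i ≤ K → r < i → DegreeTwo (P ! i)
          on-v {i} i≤K r<i = subst DegreeTwo
            (sym (trans (cong (P !_) (sym (m∸[m∸n]≡n i≤K))) (along-v Pₖ₋₁≢v₀ (m∸n≤m K i) t<s))) (deg-v t<s)
            where
            t<s : suc (K ∸ i) ≤ s
            t<s = subst (suc (K ∸ i) ≤_) (trans (cong (_∸ r) K≡r+s) (m+n∸m≡n r s)) (∸-monoʳ-< r<i i≤K)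

      Pₖ₋₁≡v₀ : P ! (3 + k') ≡ v ! 0
      Pₖ₋₁≡v₀ = decidable-stable (P ! (3 + k') ≟ v ! 0) ([ through-w , through-u₁ ]′ second)

      Pₖ₋₂≡w : P ! (2 + k') ≡ w
      Pₖ₋₂≡w = [ id , (λ P≡v₁ → ⊥-elim (m≢1+n+m (2 + k') {1}
                                     (injective P (m≤n+m _ 2) ≤-refl (trans P≡v₁ (sym Pₖ))))) ]′
                 (neighbours-v₀ (edge-sym (subst (Edge (P ! (2 + k'))) Pₖ₋₁≡v₀ (adjacent P (n≤1+n _)))))

      P₁≡u₁ : P ! 1 ≡ u ! 1
      P₁≡u₁ = [ (λ P₁≡w → contradiction (injective P (m≤m+n 1 _) (m≤n+m _ 2) (trans P₁≡w (sym Pₖ₋₂≡w))) λ ())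
              , id ]′ second

      r≤K-2 : r ≤ 2 + k'
      r≤K-2 = ≤-pred (≤∧≢⇒< (≤-pred r<K) λ r≡K-1 →
                disjoint ≤-refl z≤n (trans (sym (along-u P₁≡u₁ ≤-refl)) (trans (cong (P !_) r≡K-1) Pₖ₋₁≡v₀)))

    path-from-common-neighbour : Σ ℕ λ L → L + r + 3 ≡ 5 + k' × Σ (ℕPath (adj G) L) λ Q →
      Q ! 0 ≡ w × Q ! L ≡ u ! r × (∀ {i} → i ≤ L → Q ! i ≢ u ! 0)
    path-from-common-neighbour = L , L+r+3≡k , Q , Q₀ , Qₗ , avoids
      where
      -- Q is P read backwards from P_{K−2} = w to P_r = u_r.
      L = 2 + k' ∸ r
      r+L≡K-2 : r + L ≡ 2 + k'
      r+L≡K-2 = m+[n∸m]≡n r≤K-2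
      Q = reverse (segment P r L (≤-trans (≤-reflexive r+L≡K-2) (m≤n+m _ 2)))
      L+r+3≡k : L + r + 3 ≡ 5 + k'
      L+r+3≡k = trans (cong (_+ 3) (m∸n+n≡m r≤K-2)) (cong (2 +_) (+-comm k' 3))
      Q₀ : Q ! 0 ≡ w
      Q₀ = trans (cong (P !_) r+L≡K-2) Pₖ₋₂≡w
      Qₗ : Q ! L ≡ u ! r
      Qₗ = trans (cong (λ i → P ! (r + i)) (n∸n≡0 L))
             (trans (cong (P !_) (+-identityʳ r)) (along-u P₁≡u₁ ≤-refl))
      avoids : ∀ {i} → i ≤ L → Q ! i ≢ u ! 0
      avoids {i} _ Qᵢ≡u₀ = m<n⇒n≢0 1≤r (m+n≡0⇒m≡0 r (injective P
        (≤-trans (+-monoʳ-≤ r (m∸n≤m L i)) (≤-trans (≤-reflexive r+L≡K-2) (m≤n+m _ 2))) z≤n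
        (trans Qᵢ≡u₀ (sym P₀))))

lemma4p3 : (k n : ℕ) → 5 ≤ k → (G : Graph n) → Saturated k G →
    (r s : ℕ) (U : Path (adj G) r) (V : Path (adj G) s) →
    (∀ (i : Fin (suc r)) (j : Fin (suc s)) → vtx U i ≢ vtx V j) →
    (∀ (i : Fin (suc r)) → degree G (vtx U i) ≡ 2) →
    (∀ (j : Fin (suc s)) → degree G (vtx V j) ≡ 2) →
    k ∸ 1 ≤ r + s →
    (w : Fin n) → adj G w (start U) ≡ true → adj G w (start V) ≡ true →
    Σ ℕ (λ L → (L + r + 3 ≡ k) × Σ (Path (adj G) L) (λ P →
      (start P ≡ w) × (end P ≡ end U) ×
      (∀ (i : Fin (suc L)) → vtx P i ≢ start U)))
lemma4p3 k n 5≤k G saturated r s U V disjoint deg-U deg-V long w w~U₀ w~V₀ with m≤n⇒∃[o]m+o≡n 5≤k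
... | k' , refl =
  let open Saturation G k' saturated
      L , L+r+3≡k , Q , Q₀ , Qₗ , avoids = path-from-common-neighbour (fromPath U) (fromPath V)
        (λ {i} {j} _ _ → disjoint (clamp r i) (clamp s j))
        (λ {i} _ → deg-U (clamp r i)) (λ {j} _ → deg-V (clamp s j)) long
        (subst (Edge w) (sym (start-fromPath U)) w~U₀) (subst (Edge w) (sym (start-fromPath V)) w~V₀)
  in L , L+r+3≡k , toPath Q , Q₀ , trans (end-toPath Q) (trans Qₗ (end-fromPath U)) ,
     λ i Qᵢ≡U₀ → avoids (≤-pred (toℕ<n i)) (trans Qᵢ≡U₀ (sym (start-fromPath U)))
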